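{- Let $\mathbb{Q}=(\Omega,\leq,\otimes,\mathsf{k})$ be a Lawverian quantale and let $(A,R)$ be a $\mathbb{Q}$-abstract rewriting system. Then $R^{ - }$ admits induction if and only if $R$ is strongly normalizing.
   Context: A quantale is a complete lattice $(\Omega,\leq)$ with a monoid $(\Omega,\otimes,\mathsf{k})$ whose multiplication distributes over arbitrary joins in each argument; Lawverian means commutative, integral ($\mathsf{k}$ is top), cointegral ($\varepsilon\otimes\delta=\bot$ implies $\varepsilon=\bot$ or $\delta=\bot$), non-trivial ($\mathsf{k}\neq\bot$). $\varepsilon\multimap\delta:=\bigvee\{\eta\mid\varepsilon\otimes\eta\leq\delta\}$. A $\mathbb{Q}$-abstract rewriting system is a pair $(A,R)$ with $R\colon A\times A\to\Omega$; $R^{ - }(b,a)=R(a,b)$. For $T\colon A\times A\to\Omega$, a map $p\colon A\to\Omega$ is $T$-inductive if $\bigwedge_{a\in A}(T(a,b)\multimap p(a))\leq p(b)$ for every $b\in A$; $T$ admits induction if every $T$-inductive $p$ satisfies $p(a)=\mathsf{k}$ for all $a\in A$. A finite sequence $(a_0,\dots,a_n)$ is an $R$-reduction sequence if $R(a_0,a_1)\otimes\cdots\otimes R(a_{n-1},a_n)\neq\bot$; an infinite sequence $(a_0,a_1,\dots)$ is one if this holds for every $n$. An element $a$ is a normal form if $\bigvee_b R(a,b)=\bot$. $R$ is strongly normalizing if every reduction sequence from any $a\in A$ terminates (ends in a normal form), i.e. there is no infinite $R$-reduction sequence. -}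

module Defs where

open import Data.Empty using () renaming (⊥ to Empty)
open import Data.Nat using (ℕ; zero; suc)
open import Data.Product using (Σ; proj₁)
open import Data.Sum using (_⊎_)
open import Relation.Nullary using (¬_)
open import Relation.Binary.PropositionalEquality using (_≡_; _≢_)

-- The bottom element is the join of the empty family.
record LawverianQuantale : Set₁ where
  infix 4 _≤_
  infixl 7 _⊗_
  field
    Ω        : Set
    _≤_      : Ω → Ω → Set
    ≤-refl   : ∀ x → x ≤ x
    ≤-trans  : ∀ {x y z} → x ≤ y → y ≤ z → x ≤ z
    ≤-antisym : ∀ {x y} → x ≤ y → y ≤ x → x ≡ y
    ⋁        : {I : Set} → (I → Ω) → Ω
    ⋁-ub     : ∀ {I : Set} (f : I → Ω) (i : I) → f i ≤ ⋁ f
    ⋁-least  : ∀ {I : Set} (f : I → Ω) (x : Ω) → (∀ i → f i ≤ x) → ⋁ f ≤ x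
    _⊗_      : Ω → Ω → Ω
    k        : Ω
    ⊗-assoc  : ∀ x y z → (x ⊗ y) ⊗ z ≡ x ⊗ (y ⊗ z)
    ⊗-identityˡ : ∀ x → k ⊗ x ≡ x
    ⊗-identityʳ : ∀ x → x ⊗ k ≡ x
    ⊗-distribˡ : ∀ x {I : Set} (f : I → Ω) → x ⊗ ⋁ f ≡ ⋁ (λ i → x ⊗ f i)
    ⊗-distribʳ : ∀ x {I : Set} (f : I → Ω) → ⋁ f ⊗ x ≡ ⋁ (λ i → f i ⊗ x)
    ⊗-comm   : ∀ x y → x ⊗ y ≡ y ⊗ x
    integral : ∀ x → x ≤ k
    cointegral : ∀ ε δ → ε ⊗ δ ≡ ⋁ {Empty} (λ ()) →
                 (ε ≡ ⋁ {Empty} (λ ())) ⊎ (δ ≡ ⋁ {Empty} (λ ()))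
    nontrivial : k ≢ ⋁ {Empty} (λ ())

module QARS (Q : LawverianQuantale) where
  open LawverianQuantale Q

  ⊥Ω : Ω
  ⊥Ω = ⋁ {Empty} (λ ())

  ⋀ : {I : Set} → (I → Ω) → Ω
  ⋀ {I} f = ⋁ {Σ Ω (λ x → ∀ i → x ≤ f i)} proj₁

  _⊸_ : Ω → Ω → Ω
  ε ⊸ δ = ⋁ {Σ Ω (λ η → ε ⊗ η ≤ δ)} proj₁

  module _ {A : Set} where
    _⁻ : (A → A → Ω) → (A → A → Ω)
    (R ⁻) b a = R a b

    Inductive : (A → A → Ω) → (A → Ω) → Set
    Inductive T p = ∀ (b : A) → ⋀ (λ (a : A) → T a b ⊸ p a) ≤ p b

    AdmitsInduction : (A → A → Ω) → Set
    AdmitsInduction T = ∀ (p : A → Ω) → Inductive T p → ∀ (a : A) → p a ≡ k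

    chain : (A → A → Ω) → (ℕ → A) → ℕ → Ω
    chain R f zero    = k
    chain R f (suc n) = chain R f n ⊗ R (f n) (f (suc n))

    InfiniteReductionSeq : (A → A → Ω) → (ℕ → A) → Set
    InfiniteReductionSeq R f = ∀ (n : ℕ) → chain R f n ≢ ⊥Ω

    StronglyNormalizing : (A → A → Ω) → Set
    StronglyNormalizing R = ¬ Σ (ℕ → A) (InfiniteReductionSeq R)

module Submission where

-- A divergent element b carries the Ω-truth value ⊥ of "b has no infinite reduction
-- sequence", and this predicate is R⁻-inductive because the first step of an infinite
-- sequence from b leads to another divergent element; so induction forces strong
-- normalization.  Conversely, if an R⁻-inductive q is not k at some a, inductivity
-- yields a step a → a' with q a' ≠ k, and iterating it builds an infinite reduction
-- sequence.  Cointegrality is what makes a product of non-⊥ steps non-⊥.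

open import Defs
open import Axiom.ExcludedMiddle using (ExcludedMiddle)
open import Axiom.DoubleNegationElimination using (em⇒dne)
open import Level using (0ℓ)
open import Function.Bundles using (_⇔_; mk⇔)
open import Data.Empty using (⊥-elim)
open import Data.Nat using (ℕ; zero; suc)
open import Data.Product using (Σ; _×_; _,_; proj₁; proj₂)
open import Data.Sum using (_⊎_; inj₁; inj₂)
open import Relation.Nullary using (¬_; yes; no)
open import Relation.Binary.PropositionalEquality
  using (_≡_; _≢_; refl; sym; trans; cong; subst)

iterate-choice : {A : Set} (P : A → Set) (S : A → A → Set) →
  (∀ b → P b → Σ A λ a → S b a × P a) →
  ∀ {a₀} → P a₀ → Σ (ℕ → A) λ f → f 0 ≡ a₀ × (∀ n → S (f n) (f (suc n)))
iterate-choice {A} P S step {a₀} pa₀ = (λ n → proj₁ (walk n)) , refl , λ n → proj₁ (proj₂ (next n))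
  where
  walk : ℕ → Σ A P
  next : ∀ n → Σ A λ a → S (proj₁ (walk n)) a × P a
  walk zero    = a₀ , pa₀
  walk (suc n) = proj₁ (next n) , proj₂ (proj₂ (next n))
  next n = step (proj₁ (walk n)) (proj₂ (walk n))

module LawverianQuantaleProperties (Q : LawverianQuantale) where
  open LawverianQuantale Q
  open QARS Q

  ⊥-least : ∀ x → ⊥Ω ≤ x
  ⊥-least x = ⋁-least _ x (λ ())

  ≤⊥⇒≡⊥ : ∀ {x} → x ≤ ⊥Ω → x ≡ ⊥Ω
  ≤⊥⇒≡⊥ x≤⊥ = ≤-antisym x≤⊥ (⊥-least _)

  ⊗-zeroʳ : ∀ x → x ⊗ ⊥Ω ≡ ⊥Ω
  ⊗-zeroʳ x = ≤⊥⇒≡⊥ (subst (_≤ ⊥Ω) (sym (⊗-distribˡ x (λ ()))) (⋁-least _ _ (λ ())))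

  ⊗-≢⊥ : ∀ {ε δ} → ε ≢ ⊥Ω → δ ≢ ⊥Ω → ε ⊗ δ ≢ ⊥Ω
  ⊗-≢⊥ {ε} {δ} ε≢⊥ δ≢⊥ ε⊗δ≡⊥ with cointegral ε δ ε⊗δ≡⊥
  ... | inj₁ ε≡⊥ = ε≢⊥ ε≡⊥
  ... | inj₂ δ≡⊥ = δ≢⊥ δ≡⊥

  ⋀-lowerBound : ∀ {I : Set} (f : I → Ω) i → ⋀ f ≤ f i
  ⋀-lowerBound f i = ⋁-least _ _ (λ (x , x≤f) → x≤f i)

  ⋀-greatest : ∀ {I : Set} (f : I → Ω) {x} → (∀ i → x ≤ f i) → x ≤ ⋀ f
  ⋀-greatest f {x} x≤f = ⋁-ub proj₁ (x , x≤f)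

  ⊸-intro : ∀ {ε δ η} → ε ⊗ η ≤ δ → η ≤ ε ⊸ δ
  ⊸-intro {η = η} ε⊗η≤δ = ⋁-ub proj₁ (η , ε⊗η≤δ)

  ⊸-⊥ : ∀ {ε} → ε ≢ ⊥Ω → ε ⊸ ⊥Ω ≤ ⊥Ω
  ⊸-⊥ {ε} ε≢⊥ = ⋁-least _ _ λ (η , ε⊗η≤⊥) →
    subst (_≤ ⊥Ω) (sym (η≡⊥ η ε⊗η≤⊥)) (≤-refl _)
    where
    η≡⊥ : ∀ η → ε ⊗ η ≤ ⊥Ω → η ≡ ⊥Ω
    η≡⊥ η ε⊗η≤⊥ with cointegral ε η (≤⊥⇒≡⊥ ε⊗η≤⊥)
    ... | inj₁ ε≡⊥ = ⊥-elim (ε≢⊥ ε≡⊥)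
    ... | inj₂ η≡⊥ = η≡⊥

  ⌜_⌝ : Set → Ω
  ⌜ P ⌝ = ⋁ {P} (λ _ → k)

  ⌜⌝-true : ∀ {P} → P → ⌜ P ⌝ ≡ k
  ⌜⌝-true p = ≤-antisym (integral _) (⋁-ub _ p)

  ⌜⌝-false : ∀ {P} → ¬ P → ⌜ P ⌝ ≡ ⊥Ω
  ⌜⌝-false ¬p = ≤⊥⇒≡⊥ (⋁-least _ _ (λ p → ⊥-elim (¬p p)))

module Rewriting (Q : LawverianQuantale) {A : Set} (R : A → A → LawverianQuantale.Ω Q) where
  open LawverianQuantale Q
  open QARS Q
  open LawverianQuantaleProperties Q

  Steps : (ℕ → A) → Set
  Steps f = ∀ n → R (f n) (f (suc n)) ≢ ⊥Ω

  Diverges : A → Set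
  Diverges a = Σ (ℕ → A) λ f → f 0 ≡ a × Steps f

  InfiniteReductionSeq⇒Steps : ∀ {f} → InfiniteReductionSeq R f → Steps f
  InfiniteReductionSeq⇒Steps {f} inf n step≡⊥ =
    inf (suc n) (trans (cong (chain R f n ⊗_) step≡⊥) (⊗-zeroʳ _))

  Steps⇒InfiniteReductionSeq : ∀ {f} → Steps f → InfiniteReductionSeq R f
  Steps⇒InfiniteReductionSeq steps zero    = nontrivial
  Steps⇒InfiniteReductionSeq steps (suc n) =
    ⊗-≢⊥ (Steps⇒InfiniteReductionSeq steps n) (steps n)

  module Classical (em : ExcludedMiddle 0ℓ) where
    private
      dne : ∀ {P : Set} → ¬ ¬ P → P
      dne = em⇒dne em

    nonDivergence : A → Ω
    nonDivergence b = ⌜ ¬ Diverges b ⌝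

    nonDivergence-inductive : Inductive (R ⁻) nonDivergence
    nonDivergence-inductive b with em {Diverges b}
    ... | no ¬div = subst (λ v → ⋀ (λ a → R b a ⊸ nonDivergence a) ≤ v)
                          (sym (⌜⌝-true ¬div)) (integral _)
    ... | yes (f , refl , steps) =
      ≤-trans (⋀-lowerBound _ (f 1))
        (subst (λ v → R (f 0) (f 1) ⊸ v ≤ nonDivergence (f 0))
          (sym (⌜⌝-false (λ ¬div → ¬div tail-diverges)))
          (≤-trans (⊸-⊥ (steps 0)) (⊥-least _)))
      where
      tail-diverges : Diverges (f 1)
      tail-diverges = (λ n → f (suc n)) , refl , (λ n → steps (suc n))

    admitsInduction⇒stronglyNormalizing : AdmitsInduction (R ⁻) → StronglyNormalizing R
    admitsInduction⇒stronglyNormalizing induction (f , inf) =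
      nontrivial (trans (sym (induction nonDivergence nonDivergence-inductive (f 0)))
                 (⌜⌝-false (λ ¬div → ¬div (f , refl , InfiniteReductionSeq⇒Steps inf))))

    inductive-step : ∀ {q} → Inductive (R ⁻) q →
      ∀ b → q b ≢ k → Σ A λ a → R b a ≢ ⊥Ω × q a ≢ k
    inductive-step {q} ind b qb≢k = dne λ noStep →
      qb≢k (≤-antisym (integral _) (≤-trans (⋀-greatest _ (k≤⊸ noStep)) (ind b)))
      where
      k≤⊸ : ¬ (Σ A λ a → R b a ≢ ⊥Ω × q a ≢ k) → ∀ a → k ≤ R b a ⊸ q a
      k≤⊸ noStep a with dne {R b a ≡ ⊥Ω ⊎ q a ≡ k}
                              (λ ¬or → noStep (a , (λ e → ¬or (inj₁ e)) , (λ e → ¬or (inj₂ e))))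
      ... | inj₁ Rba≡⊥ = ⊸-intro (subst (_≤ q a) (sym (trans (⊗-identityʳ _) Rba≡⊥)) (⊥-least _))
      ... | inj₂ qa≡k  = ⊸-intro (subst (R b a ⊗ k ≤_) (sym qa≡k) (integral _))

    stronglyNormalizing⇒admitsInduction : StronglyNormalizing R → AdmitsInduction (R ⁻)
    stronglyNormalizing⇒admitsInduction sn q ind a = dne λ qa≢k →
      let f , _ , steps = iterate-choice (λ b → q b ≢ k) (λ b a → R b a ≢ ⊥Ω)
                                         (inductive-step ind) qa≢k
      in sn (f , Steps⇒InfiniteReductionSeq steps)

mainTheorem4 : ExcludedMiddle 0ℓ → (Q : LawverianQuantale) →
    let open LawverianQuantale Q in
    let open QARS Q in
    (A : Set) (R : A → A → Ω) →
    AdmitsInduction (R ⁻) ⇔ StronglyNormalizing R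
mainTheorem4 em Q A R =
  mk⇔ admitsInduction⇒stronglyNormalizing stronglyNormalizing⇒admitsInduction
  where open Rewriting.Classical Q R em
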